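{- The sequent $\forall x\,(N(x)\to sx\neq 0),\ N(x),\ N(y),\ x\le y\ \vdash\ y=0\to x=0$ is provable in $\mathrm{LKID}(\Sigma_N\cup\{\le\},\Phi_N\cup\Phi_\le)$.
   Context: Signature $\Sigma_N$: constant $0$, unary function $s$, ordinary binary predicate $p$, inductive unary predicate $N$, with equality; $\Sigma_N\cup\{\le\}$ adds an inductive binary predicate $\le$. $\Phi_N$: productions $N(0)$ and (from $N(x)$ infer $N(sx)$). $\Phi_\le$: productions $x\le x$ and (from $x\le y$ infer $x\le sy$). $\mathrm{LKID}(\Sigma,\Phi)$ is the classical first-order sequent calculus with equality (axiom, weakening, cut, substitution, standard logical rules, equality rules) plus right-introduction rules for the productions and induction rules. For $N$: right rules $\Gamma\vdash\Delta,N0$ and (from $\Gamma\vdash\Delta,Nt$ infer $\Gamma\vdash\Delta,N(st)$); induction: from $\Gamma\vdash F0,\Delta$, $\Gamma,Fx\vdash F(sx),\Delta$ ($x$ fresh), $\Gamma,Ft\vdash\Delta$ infer $\Gamma,Nt\vdash\Delta$. For $\le$: right rules $\Gamma\vdash\Delta,t\le t$ and (from $\Gamma\vdash\Delta,t\le u$ infer $\Gamma\vdash\Delta,t\le su$); induction: for any formula $F(z_1,z_2)$, from $\Gamma\vdash F(y,y),\Delta$, $\Gamma,F(y_1,y_2)\vdash F(y_1,sy_2),\Delta$ ($y,y_1,y_2$ fresh) and $\Gamma,F(t_1,t_2)\vdash\Delta$ infer $\Gamma,t_1\le t_2\vdash\Delta$. -}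

module Defs where

-- Variables are de Bruijn indices (var 0 is the most recently bound /
-- most recently introduced variable).  Eigenvariable ("fresh")
-- conditions are realised by shifting the side context, which is the
-- standard de Bruijn rendering of freshness.

open import Data.Nat using (ℕ; zero; suc)
open import Data.List using (List; []; _∷_; map)
open import Data.List.Membership.Propositional using (_∈_)

data Term : Set where
  var  : ℕ → Term
  zer  : Term
  s    : Term → Term

data Form : Set where
  _≐_   : Term → Term → Form
  P     : Term → Term → Form
  N     : Term → Form
  _≤ᵢ_  : Term → Term → Form
  ¬′_   : Form → Form
  _∧′_  : Form → Form → Form
  _∨′_  : Form → Form → Form
  _⇒_   : Form → Form → Form
  ∀′    : Form → Form
  ∃′    : Form → Form

infix 30 _≐_ _≤ᵢ_
infix 25 ¬′_
infixr 20 _∧′_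
infixr 19 _∨′_
infixr 18 _⇒_

Subst : Set
Subst = ℕ → Term

tsub : Subst → Term → Term
tsub σ (var n) = σ n
tsub σ zer     = zer
tsub σ (s t)   = s (tsub σ t)

shiftT : Term → Term
shiftT = tsub (λ n → var (suc n))

exts : Subst → Subst
exts σ zero    = var zero
exts σ (suc n) = shiftT (σ n)

fsub : Subst → Form → Form
fsub σ (t ≐ u)   = tsub σ t ≐ tsub σ u
fsub σ (P t u)   = P (tsub σ t) (tsub σ u)
fsub σ (N t)     = N (tsub σ t)
fsub σ (t ≤ᵢ u)  = tsub σ t ≤ᵢ tsub σ u
fsub σ (¬′ F)    = ¬′ fsub σ F
fsub σ (F ∧′ G)  = fsub σ F ∧′ fsub σ G
fsub σ (F ∨′ G)  = fsub σ F ∨′ fsub σ G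
fsub σ (F ⇒ G)   = fsub σ F ⇒ fsub σ G
fsub σ (∀′ F)    = ∀′ (fsub (exts σ) F)
fsub σ (∃′ F)    = ∃′ (fsub (exts σ) F)

-- shift all free variables up by one / by two (fresh variables become var 0 / var 0,1)
shift : Form → Form
shift = fsub (λ n → var (suc n))

shift2 : Form → Form
shift2 = fsub (λ n → var (suc (suc n)))

-- F has a distinguished parameter var 0;  inst1 t F  =  F(t)
σ1 : Term → Subst
σ1 t zero    = t
σ1 t (suc n) = var n

inst1 : Term → Form → Form
inst1 t = fsub (σ1 t)

-- F has distinguished parameters var 0, var 1;  inst2 t u F  =  F(t,u)
σ2 : Term → Term → Subst
σ2 t u zero          = t
σ2 t u (suc zero)    = u
σ2 t u (suc (suc n)) = var n

inst2 : Term → Term → Form → Form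
inst2 t u = fsub (σ2 t u)

σsucc : Subst
σsucc zero    = s (var zero)
σsucc (suc n) = var (suc n)

-- F(y,y) in the context extended by one fresh y = var 0
σdiag : Subst
σdiag zero          = var zero
σdiag (suc zero)    = var zero
σdiag (suc (suc n)) = var (suc n)

σsucc2 : Subst
σsucc2 zero          = var zero
σsucc2 (suc zero)    = s (var (suc zero))
σsucc2 (suc (suc n)) = var (suc (suc n))

_⊆ₛ_ : List Form → List Form → Set
Γ ⊆ₛ Γ′ = ∀ {F} → F ∈ Γ → F ∈ Γ′

-- Sequents Γ ⊢ Δ ; lists read as sets via the structural rule `wk`
-- (which gives weakening, exchange and contraction).
infix 2 _⊢_
data _⊢_ : List Form → List Form → Set where
  ax    : ∀ F → (F ∷ []) ⊢ (F ∷ [])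
  wk    : ∀ {Γ Δ Γ′ Δ′} → Γ ⊆ₛ Γ′ → Δ ⊆ₛ Δ′ → Γ ⊢ Δ → Γ′ ⊢ Δ′
  cut   : ∀ {Γ Δ} F → Γ ⊢ F ∷ Δ → F ∷ Γ ⊢ Δ → Γ ⊢ Δ
  subst : ∀ {Γ Δ} (θ : Subst) → Γ ⊢ Δ → map (fsub θ) Γ ⊢ map (fsub θ) Δ
  =R    : ∀ {Γ Δ} t → Γ ⊢ (t ≐ t) ∷ Δ
  =L    : ∀ (Γ Δ : List Form) t u →
          map (inst2 u t) Γ ⊢ map (inst2 u t) Δ →
          (t ≐ u) ∷ map (inst2 t u) Γ ⊢ map (inst2 t u) Δ
  ¬L    : ∀ {Γ Δ F} → Γ ⊢ F ∷ Δ → (¬′ F) ∷ Γ ⊢ Δ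
  ¬R    : ∀ {Γ Δ F} → F ∷ Γ ⊢ Δ → Γ ⊢ (¬′ F) ∷ Δ
  ∧L    : ∀ {Γ Δ F G} → F ∷ G ∷ Γ ⊢ Δ → (F ∧′ G) ∷ Γ ⊢ Δ
  ∧R    : ∀ {Γ Δ F G} → Γ ⊢ F ∷ Δ → Γ ⊢ G ∷ Δ → Γ ⊢ (F ∧′ G) ∷ Δ
  ∨L    : ∀ {Γ Δ F G} → F ∷ Γ ⊢ Δ → G ∷ Γ ⊢ Δ → (F ∨′ G) ∷ Γ ⊢ Δ
  ∨R    : ∀ {Γ Δ F G} → Γ ⊢ F ∷ G ∷ Δ → Γ ⊢ (F ∨′ G) ∷ Δ
  ⇒L    : ∀ {Γ Δ F G} → Γ ⊢ F ∷ Δ → G ∷ Γ ⊢ Δ → (F ⇒ G) ∷ Γ ⊢ Δ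
  ⇒R    : ∀ {Γ Δ F G} → F ∷ Γ ⊢ G ∷ Δ → Γ ⊢ (F ⇒ G) ∷ Δ
  ∀L    : ∀ {Γ Δ F} t → inst1 t F ∷ Γ ⊢ Δ → (∀′ F) ∷ Γ ⊢ Δ
  ∀R    : ∀ {Γ Δ F} → map shift Γ ⊢ F ∷ map shift Δ → Γ ⊢ (∀′ F) ∷ Δ
  ∃L    : ∀ {Γ Δ F} → F ∷ map shift Γ ⊢ map shift Δ → (∃′ F) ∷ Γ ⊢ Δ
  ∃R    : ∀ {Γ Δ F} t → Γ ⊢ inst1 t F ∷ Δ → Γ ⊢ (∃′ F) ∷ Δ
  NR₀   : ∀ {Γ Δ} → Γ ⊢ N zer ∷ Δ
  NR₁   : ∀ {Γ Δ t} → Γ ⊢ N t ∷ Δ → Γ ⊢ N (s t) ∷ Δ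
  -- induction for N; F(z) has parameter z = var 0
  IndN  : ∀ {Γ Δ} F t →
          Γ ⊢ inst1 zer F ∷ Δ →
          F ∷ map shift Γ ⊢ fsub σsucc F ∷ map shift Δ →
          inst1 t F ∷ Γ ⊢ Δ →
          N t ∷ Γ ⊢ Δ
  ≤R₀   : ∀ {Γ Δ} t → Γ ⊢ (t ≤ᵢ t) ∷ Δ
  ≤R₁   : ∀ {Γ Δ t u} → Γ ⊢ (t ≤ᵢ u) ∷ Δ → Γ ⊢ (t ≤ᵢ s u) ∷ Δ
  -- induction for ≤; F(z1,z2) has parameters z1 = var 0, z2 = var 1
  Ind≤  : ∀ {Γ Δ} F t₁ t₂ →
          map shift Γ ⊢ fsub σdiag F ∷ map shift Δ →
          F ∷ map shift2 Γ ⊢ fsub σsucc2 F ∷ map shift2 Δ →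
          inst2 t₁ t₂ F ∷ Γ ⊢ Δ →
          (t₁ ≤ᵢ t₂) ∷ Γ ⊢ Δ

x y : Term
x = var 0
y = var 1

hyp : Form
hyp = ∀′ (N (var 0) ⇒ ¬′ (s (var 0) ≐ zer))

-- Induct on x ≤ y with the strengthened motive F(z₁,z₂) := N z₁ → N z₂ ∧ (z₂ = 0 → z₁ = 0).  For the step F(y₁,y₂) ⊢ F(y₁,sy₂), N y₁ yields N y₂,
-- hence N(sy₂); and the hypothesis ∀x (N x → sx ≠ 0), applicable because N y₂ is carried
-- along, refutes sy₂ = 0.  Finally F(x,y) together with N x gives y = 0 → x = 0.
module Submission where

open import Defs
open import Data.List using (List; []; _∷_; map)
open import Data.List.Membership.Propositional using (_∈_)
open import Data.List.Membership.Propositional.Properties using (∈-map⁺)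
open import Data.List.Relation.Unary.Any using (here; there)
open import Relation.Binary.PropositionalEquality using (refl)
open import Function using (id)

private
  variable
    Γ Δ : List Form
    A B : Form
    t u : Term

singleton⊆ : A ∈ Γ → (A ∷ []) ⊆ₛ Γ
singleton⊆ A∈Γ (here refl) = A∈Γ

contract : A ∈ Γ → (A ∷ Γ) ⊆ₛ Γ
contract A∈Γ (here refl) = A∈Γ
contract A∈Γ (there B∈Γ) = B∈Γ

ax-∈ : A ∈ Γ → A ∈ Δ → Γ ⊢ Δ
ax-∈ {A} A∈Γ A∈Δ = wk (singleton⊆ A∈Γ) (singleton⊆ A∈Δ) (ax A)

⇒L-∈ : (A ⇒ B) ∈ Γ → Γ ⊢ A ∷ Δ → B ∷ Γ ⊢ Δ → Γ ⊢ Δ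
⇒L-∈ A⇒B∈Γ ⊢A B⊢ = wk (contract A⇒B∈Γ) id (⇒L ⊢A B⊢)

∀L-∈ : ∀ {F} → ∀′ F ∈ Γ → ∀ t → inst1 t F ∷ Γ ⊢ Δ → Γ ⊢ Δ
∀L-∈ ∀F∈Γ t Ft⊢ = wk (contract ∀F∈Γ) id (∀L t Ft⊢)

Ind≤-∈ : ∀ F → (t ≤ᵢ u) ∈ Γ →
         map shift Γ ⊢ fsub σdiag F ∷ map shift Δ →
         F ∷ map shift2 Γ ⊢ fsub σsucc2 F ∷ map shift2 Δ →
         inst2 t u F ∷ Γ ⊢ Δ →
         Γ ⊢ Δ
Ind≤-∈ {t} {u} F t≤u∈Γ base step conclusion =
  wk (contract t≤u∈Γ) id (Ind≤ F t u base step conclusion)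

succ≐zero-absurd : hyp ∈ Γ → N t ∈ Γ → (s t ≐ zer) ∈ Γ → Γ ⊢ Δ
succ≐zero-absurd {t = t} hyp∈Γ Nt∈Γ st≐0∈Γ =
  ∀L-∈ hyp∈Γ t (⇒L (ax-∈ Nt∈Γ (here refl)) (¬L (ax-∈ st≐0∈Γ (here refl))))

≤-motive : Form
≤-motive = N (var 0) ⇒ N (var 1) ∧′ ((var 1 ≐ zer) ⇒ (var 0 ≐ zer))

≤-motive-refl : Γ ⊢ fsub σdiag ≤-motive ∷ Δ
≤-motive-refl = ⇒R (∧R (ax-∈ (here refl) (here refl)) (⇒R (ax-∈ (here refl) (here refl))))

≤-motive-step : hyp ∈ Γ → ≤-motive ∷ Γ ⊢ fsub σsucc2 ≤-motive ∷ Δ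
≤-motive-step hyp∈Γ =
  ⇒R (⇒L-∈ (there (here refl)) (ax-∈ (here refl) (here refl))
       (∧L (∧R (NR₁ (ax-∈ (here refl) (here refl)))
               (⇒R (succ≐zero-absurd (there (there (there (there (there hyp∈Γ)))))
                                     (there (here refl)) (here refl))))))

≤-motive-elim : N t ∈ Γ → inst2 t u ≤-motive ∷ Γ ⊢ ((u ≐ zer) ⇒ (t ≐ zer)) ∷ Δ
≤-motive-elim Nt∈Γ = ⇒L (ax-∈ Nt∈Γ (here refl)) (∧L (ax-∈ (there (here refl)) (here refl)))

lemma3p6 : hyp ∷ N x ∷ N y ∷ (x ≤ᵢ y) ∷ [] ⊢ ((y ≐ zer) ⇒ (x ≐ zer)) ∷ []
-- hyp is closed, so shift2 hyp is hyp by computation.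
lemma3p6 = Ind≤-∈ ≤-motive (there (there (there (here refl))))
  ≤-motive-refl
  (≤-motive-step (∈-map⁺ shift2 {x = hyp} (here refl)))
  (≤-motive-elim (there (here refl)))
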